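{- Let $\mathcal D$ be a biplane with point set $P$ and block set $B$. Then its incidence graph, the bipartite graph $G=(X,Y)$ with $X=P$, $Y=B$, and $x\in X$ adjacent to $y\in Y$ exactly when the point $x$ lies in the block $y$, satisfies the double Hall property.
   Context: A biplane is a symmetric block design with $\lambda=2$: a finite set $P$ of $v$ points and a family $B$ of $v$ blocks (subsets of $P$, each of the same size $k$) such that every two distinct points lie in exactly two common blocks and every two distinct blocks intersect in exactly two points. For a vertex set $S$, $\Lambda^2(S)$ denotes the set of vertices adjacent to at least two vertices of $S$. A bipartite graph $G=(X,Y)$ with $|X|\ge 2$ satisfies the double Hall property if $|\Lambda^2(S)|\ge |S|$ for every $S\subseteq X$ with $|S|\ge 2$. -}

module Defs where

open import Data.Nat using (ℕ; _≤_; _≤?_)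
open import Data.Fin using (Fin)
open import Data.Fin.Subset using (Subset; _∈_; _∩_; ∣_∣; _⊆_; inside; outside)
open import Data.Fin.Subset.Properties using (_∈?_)
open import Data.Vec using (tabulate)
open import Data.Product using (_×_)
open import Data.Bool using (Bool; true; false; _∧_)
open import Relation.Binary.PropositionalEquality using (_≡_)
open import Relation.Nullary using (¬_; yes; no; does)

-- Points are Fin v, blocks are indexed by Fin v; block j is the point set blk j.
-- Incidence: point x lies in block j  iff  x ∈ blk j.

blocksThrough : {v : ℕ} → (Fin v → Subset v) → Fin v → Fin v → Subset v
blocksThrough blk x x' = tabulate (λ j → does (x ∈? blk j) ∧ does (x' ∈? blk j))

record IsBiplane (v : ℕ) (blk : Fin v → Subset v) : Set where
  field
    k : ℕ
    blockSize : ∀ j → ∣ blk j ∣ ≡ k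
    pointPairs : ∀ x x' → ¬ x ≡ x' → ∣ blocksThrough blk x x' ∣ ≡ 2
    blockPairs : ∀ j j' → ¬ j ≡ j' → ∣ blk j ∩ blk j' ∣ ≡ 2

Λ² : {v : ℕ} → (Fin v → Subset v) → Subset v → Subset v
Λ² blk S = tabulate (λ j → does (2 ≤? ∣ S ∩ blk j ∣))

DoubleHall : (v : ℕ) → (Fin v → Subset v) → Set
DoubleHall v blk = (2 ≤ v) × (∀ (S : Subset v) → 2 ≤ ∣ S ∣ → ∣ S ∣ ≤ ∣ Λ² blk S ∣)

{-# OPTIONS --safe #-}
-- Fix S ⊆ P with |S| ≥ 2 and let T = Λ²(S). Any two points of S lie on exactly two blocks of T,
-- and two blocks of T share at most two points of S; nothing else about the biplane is used.
-- Write a_j = |S ∩ j| and r_x for the number of blocks of T through x. If x ∈ S lies off j ∈ T,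
-- counting the pairs (y, j′) with y ∈ S ∩ j and x, y ∈ j′ ∈ T in two ways gives a_j ≤ r_x.
-- If some block of T contains S, or some point x₀ of S lies on every block of T, counting the
-- pairs (y, j) with x₀, y ∈ j ∈ T gives |S| ≤ |T| directly. Otherwise argue as for the
-- de Bruijn–Erdős theorem: |T| < |S| would give |S| (|T| − r_x) < |T| (|S| − a_j) for every
-- non-incident pair (x, j), yet summing 1 / (|S| (|T| − r_x)) and 1 / (|T| (|S| − a_j)) over the
-- non-incident pairs gives 1 both times. Multiplying by |S|! clears the denominators.
module Submission where

open import Data.Bool.Base using (Bool; true; false; not; _∧_)
open import Data.Bool.Properties using (_≟_; T-≡)
open import Data.Empty using (⊥)
open import Data.Fin.Base using (Fin; zero; suc)
open import Data.Fin.Properties using (any?; all?; ¬∀⟶∃¬)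
open import Data.Fin.Subset using (Subset; _∈_; _∩_; _-_; ∣_∣)
open import Data.Fin.Subset.Properties
  using (_∈?_; x∈p⇒∣p-x∣<∣p∣; x∈p∧x∉q⇒x∈p─q; x≢y⇒x∉⁅y⁆; x∈p∩q⁺)
open import Data.Nat.Base
open import Data.Nat.Divisibility using (_∣_; divides; quotient; ∣-trans; m∣m*n; m≤n⇒m!∣n!; _∣0)
open import Data.Nat.Properties hiding (_≟_)
open import Data.Nat.Tactic.RingSolver using (solve-∀)
open import Algebra.Properties.Semiring.Sum +-*-semiring
  using (sum; sum-syntax; sum-cong-≋; sum-replicate-zero; ∑-distrib-+; ∑-comm; *-distribˡ-sum; *-distribʳ-sum)
open import Data.Product using (∃-syntax; _×_; _,_)
open import Data.Vec.Base using ([]; _∷_; lookup)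
open import Data.Vec.Properties using (lookup∘tabulate; lookup⇒[]=)
open import Function.Base using (_∘_)
open import Function.Bundles using (Equivalence)
open import Relation.Binary.PropositionalEquality
open import Relation.Nullary using (¬_; yes; no; does; contradiction)
open import Relation.Nullary.Decidable using (dec-true; _×-dec_; _→-dec_)

open import Defs

⟦_⟧ : Bool → ℕ
⟦ true ⟧ = 1
⟦ false ⟧ = 0

⟦⟧-idem : ∀ b → ⟦ b ⟧ * ⟦ b ⟧ ≡ ⟦ b ⟧
⟦⟧-idem true = refl
⟦⟧-idem false = refl

0<⟦⟧*⟦⟧ : ∀ {a b} → a ≡ true → b ≡ true → 0 < ⟦ a ⟧ * ⟦ b ⟧
0<⟦⟧*⟦⟧ refl refl = z<s

⟦⟧*⟦not⟧+⟦⟧*⟦⟧ : ∀ a b → ⟦ a ⟧ * ⟦ not b ⟧ + ⟦ a ⟧ * ⟦ b ⟧ ≡ ⟦ a ⟧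
⟦⟧*⟦not⟧+⟦⟧*⟦⟧ true true = refl
⟦⟧*⟦not⟧+⟦⟧*⟦⟧ true false = refl
⟦⟧*⟦not⟧+⟦⟧*⟦⟧ false _ = refl

⟦⟧*⟦⟧*⟦⟧≡⟦∧⟧ : ∀ {a b c} → (b ≡ true → c ≡ true → a ≡ true) → ⟦ a ⟧ * ⟦ b ⟧ * ⟦ c ⟧ ≡ ⟦ b ∧ c ⟧
⟦⟧*⟦⟧*⟦⟧≡⟦∧⟧ {true} {true} {true} _ = refl
⟦⟧*⟦⟧*⟦⟧≡⟦∧⟧ {false} {true} {true} a⇐b∧c = contradiction (a⇐b∧c refl refl) λ ()
⟦⟧*⟦⟧*⟦⟧≡⟦∧⟧ {true} {true} {false} _ = refl
⟦⟧*⟦⟧*⟦⟧≡⟦∧⟧ {false} {true} {false} _ = refl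
⟦⟧*⟦⟧*⟦⟧≡⟦∧⟧ {true} {false} _ = refl
⟦⟧*⟦⟧*⟦⟧≡⟦∧⟧ {false} {false} _ = refl

⟦⟧*⟦⟧*⟦⟧≤⟦⟧*⟦⟧ : ∀ a b c → ⟦ a ⟧ * ⟦ b ⟧ * ⟦ c ⟧ ≤ ⟦ b ⟧ * ⟦ c ⟧
⟦⟧*⟦⟧*⟦⟧≤⟦⟧*⟦⟧ true true c = ≤-refl
⟦⟧*⟦⟧*⟦⟧≤⟦⟧*⟦⟧ true false c = z≤n
⟦⟧*⟦⟧*⟦⟧≤⟦⟧*⟦⟧ false b c = z≤n

⟦⟧*-mono : ∀ {b x y} → (b ≡ true → x ≤ y) → ⟦ b ⟧ * x ≤ ⟦ b ⟧ * y
⟦⟧*-mono {true} x≤y = *-monoʳ-≤ 1 (x≤y refl)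
⟦⟧*-mono {false} _ = z≤n

⟦⟧*⟦⟧*-mono : ∀ {a b x y} → (a ≡ true → b ≡ true → x ≤ y) → ⟦ a ⟧ * ⟦ b ⟧ * x ≤ ⟦ a ⟧ * ⟦ b ⟧ * y
⟦⟧*⟦⟧*-mono {true} {true} x≤y = *-monoʳ-≤ 1 (x≤y refl refl)
⟦⟧*⟦⟧*-mono {true} {false} _ = z≤n
⟦⟧*⟦⟧*-mono {false} _ = z≤n

⟦⟧*⟦⟧*⟦not⟧*-mono : ∀ {a b c x y} → (a ≡ true → b ≡ true → c ≡ false → x ≤ y) →
                    ⟦ a ⟧ * ⟦ b ⟧ * ⟦ not c ⟧ * x ≤ ⟦ a ⟧ * ⟦ b ⟧ * ⟦ not c ⟧ * y
⟦⟧*⟦⟧*⟦not⟧*-mono {true} {true} {false} x≤y = *-monoʳ-≤ 1 (x≤y refl refl refl)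
⟦⟧*⟦⟧*⟦not⟧*-mono {true} {true} {true} _ = z≤n
⟦⟧*⟦⟧*⟦not⟧*-mono {true} {false} _ = z≤n
⟦⟧*⟦⟧*⟦not⟧*-mono {false} _ = z≤n

⟦⟧*-∣ : ∀ {b d K} → (b ≡ true → d ∣ K) → ⟦ b ⟧ * d ∣ K * ⟦ b ⟧
⟦⟧*-∣ {true} {d} {K} d∣K = subst₂ _∣_ (sym (*-identityˡ d)) (sym (*-identityʳ K)) (d∣K refl)
⟦⟧*-∣ {false} {K = K} _ = subst (0 ∣_) (sym (*-zeroʳ K)) (0 ∣0)

quotient-⟦⟧ : ∀ {b d K} (d∣K : ⟦ b ⟧ * d ∣ K * ⟦ b ⟧) → b ≡ true → K ≡ quotient d∣K * d
quotient-⟦⟧ {d = d} {K} (divides q K≡q*d) refl = begin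
  K            ≡⟨ *-identityʳ K ⟨
  K * 1        ≡⟨ K≡q*d ⟩
  q * (1 * d)  ≡⟨ cong (q *_) (*-identityˡ d) ⟩
  q * d        ∎
  where open ≡-Reasoning

¬[a⇒b] : ∀ {a b} → ¬ (a ≡ true → b ≡ true) → a ≡ true × b ≡ false
¬[a⇒b] {true} {true} ¬a⇒b = contradiction (λ _ → refl) ¬a⇒b
¬[a⇒b] {true} {false} _ = refl , refl
¬[a⇒b] {false} ¬a⇒b = contradiction (λ ()) ¬a⇒b

∃-counterexample : ∀ {n} (p q : Fin n → Bool) →
                   ¬ (∀ i → p i ≡ true → q i ≡ true) → ∃[ i ] p i ≡ true × q i ≡ false
∃-counterexample {n} p q ¬p⊆q with ¬∀⟶∃¬ n _ (λ i → p i ≟ true →-dec q i ≟ true) ¬p⊆q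
... | i , ¬pi⇒qi = i , ¬[a⇒b] ¬pi⇒qi

≢-separated : ∀ {a} {A : Set a} (f : A → Bool) {x y} → f x ≡ false → f y ≡ true → x ≢ y
≢-separated f fx≡false fy≡true refl = contradiction (trans (sym fx≡false) fy≡true) λ ()

0<m≤n⇒m∣n! : ∀ {m n} → 0 < m → m ≤ n → m ∣ n !
0<m≤n⇒m∣n! {suc m} _ m≤n = ∣-trans (m∣m*n (m !)) (m≤n⇒m!∣n! m≤n)

reciprocal-< : ∀ {K W V d e a b} .{{_ : NonZero K}} →
               K ≡ W * d → K ≡ V * e → a * d < b * e → a * V < b * W
reciprocal-< {K} {W} {V} {d} {e} {a} {b} K≡W*d K≡V*e a*d<b*e =
  *-cancelʳ-< (d * e) (a * V) (b * W) (begin-strict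
    a * V * (d * e)  ≡⟨ shuffle a V d e ⟩
    a * d * (V * e)  ≡⟨ cong (a * d *_) K≡V*e ⟨
    a * d * K        <⟨ *-monoˡ-< K a*d<b*e ⟩
    b * e * K        ≡⟨ cong (b * e *_) K≡W*d ⟩
    b * e * (W * d)  ≡⟨ shuffle b e W d ⟩
    b * W * (e * d)  ≡⟨ cong (b * W *_) (*-comm e d) ⟩
    b * W * (d * e)  ∎)
  where
  open ≤-Reasoning
  shuffle : ∀ p q r u → p * q * (r * u) ≡ p * r * (q * u)
  shuffle = solve-∀

∑-mono-≤ : ∀ {n} {f g : Fin n → ℕ} → (∀ i → f i ≤ g i) → sum f ≤ sum g
∑-mono-≤ {zero} _ = z≤n
∑-mono-≤ {suc n} f≤g = +-mono-≤ (f≤g zero) (∑-mono-≤ (f≤g ∘ suc))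

∑-mono-< : ∀ {n} {f g : Fin n → ℕ} → (∀ i → f i ≤ g i) → ∀ k → f k < g k → sum f < sum g
∑-mono-< f≤g zero fk<gk = +-mono-<-≤ fk<gk (∑-mono-≤ (f≤g ∘ suc))
∑-mono-< f≤g (suc k) fk<gk = +-mono-≤-< (f≤g zero) (∑-mono-< (f≤g ∘ suc) k fk<gk)

∑-mono-≤-except : ∀ {n} {f g : Fin n → ℕ} (k : Fin n) {a b} →
                  (∀ i → i ≢ k → f i ≤ g i) → f k + a ≤ g k + b → sum f + a ≤ sum g + b
∑-mono-≤-except {f = f} {g} zero {a} {b} f≤g fk+a≤gk+b = begin
  f zero + F + a  ≡⟨ swap (f zero) F a ⟩
  f zero + a + F  ≤⟨ +-mono-≤ fk+a≤gk+b (∑-mono-≤ λ i → f≤g (suc i) λ ()) ⟩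
  g zero + b + G  ≡⟨ swap (g zero) b G ⟩
  g zero + G + b  ∎
  where
  open ≤-Reasoning
  F G : ℕ
  F = sum (f ∘ suc)
  G = sum (g ∘ suc)
  swap : ∀ p q r → p + q + r ≡ p + r + q
  swap = solve-∀
∑-mono-≤-except {f = f} {g} (suc k) {a} {b} f≤g fk+a≤gk+b = begin
  f zero + sum (f ∘ suc) + a    ≡⟨ +-assoc (f zero) _ a ⟩
  f zero + (sum (f ∘ suc) + a)  ≤⟨ +-mono-≤ (f≤g zero λ ()) (∑-mono-≤-except k f≤g-off-k fk+a≤gk+b) ⟩
  g zero + (sum (g ∘ suc) + b)  ≡⟨ +-assoc (g zero) _ b ⟨
  g zero + sum (g ∘ suc) + b    ∎
  where
  open ≤-Reasoning
  f≤g-off-k : ∀ i → i ≢ k → f (suc i) ≤ g (suc i)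
  f≤g-off-k i i≢k = f≤g (suc i) λ { refl → i≢k refl }

0<∑ : ∀ {n} {f : Fin n → ℕ} k → 0 < f k → 0 < sum f
0<∑ {n} {f} k 0<fk = subst (_< sum f) (sum-replicate-zero n) (∑-mono-< {f = λ _ → 0} {f} (λ _ → z≤n) k 0<fk)

∃-true : ∀ {n} (p : Fin n → Bool) → 0 < ∑[ i < n ] ⟦ p i ⟧ → ∃[ i ] p i ≡ true
∃-true {suc n} p 0<∑p with p zero in p0
... | true = zero , p0
... | false with ∃-true (p ∘ suc) 0<∑p
...   | i , pi = suc i , pi

∑-split : ∀ {n} (p q : Fin n → Bool) →
          ∑[ i < n ] (⟦ p i ⟧ * ⟦ not (q i) ⟧) + ∑[ i < n ] (⟦ p i ⟧ * ⟦ q i ⟧) ≡ ∑[ i < n ] ⟦ p i ⟧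
∑-split p q = trans (sym (∑-distrib-+ (λ i → ⟦ p i ⟧ * ⟦ not (q i) ⟧) (λ i → ⟦ p i ⟧ * ⟦ q i ⟧)))
                    (sum-cong-≋ λ i → ⟦⟧*⟦not⟧+⟦⟧*⟦⟧ (p i) (q i))

∑-swap : ∀ {m n} (u : Fin m → ℕ) (w : Fin n → ℕ) (M : Fin m → Fin n → ℕ) →
         ∑[ x < m ] (u x * ∑[ j < n ] (w j * M x j)) ≡ ∑[ j < n ] (w j * ∑[ x < m ] (u x * M x j))
∑-swap {m} {n} u w M = begin
  ∑[ x < m ] (u x * ∑[ j < n ] (w j * M x j))  ≡⟨ sum-cong-≋ (λ x → *-distribˡ-sum (u x) (λ j → w j * M x j)) ⟩
  ∑[ x < m ] ∑[ j < n ] (u x * (w j * M x j))  ≡⟨ sum-cong-≋ (λ x → sum-cong-≋ λ j → exchange (u x) (w j) (M x j)) ⟩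
  ∑[ x < m ] ∑[ j < n ] (w j * (u x * M x j))  ≡⟨ ∑-comm (λ x j → w j * (u x * M x j)) ⟩
  ∑[ j < n ] ∑[ x < m ] (w j * (u x * M x j))  ≡⟨ sum-cong-≋ (λ j → *-distribˡ-sum (w j) (λ x → u x * M x j)) ⟨
  ∑[ j < n ] (w j * ∑[ x < m ] (u x * M x j))  ∎
  where
  open ≡-Reasoning
  exchange : ∀ p q r → p * (q * r) ≡ q * (p * r)
  exchange = solve-∀

double-count-< : ∀ {m n} (c : Fin m → Fin n → ℕ) {w : Fin m → ℕ} {v : Fin n → ℕ}
                 {σ : Fin m → ℕ} {τ : Fin n → ℕ} {A B : ℕ} →
                 (∀ x → (∑[ j < n ] c x j) * w x ≡ A * σ x) →
                 (∀ j → (∑[ x < m ] c x j) * v j ≡ B * τ j) →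
                 (∀ x j → c x j * v j ≤ c x j * w x) →
                 ∀ x₀ j₀ → c x₀ j₀ * v j₀ < c x₀ j₀ * w x₀ →
                 B * sum τ < A * sum σ
double-count-< {m} {n} c {w} {v} {σ} {τ} {A} {B} rows cols c*v≤c*w x₀ j₀ c*v<c*w = begin-strict
  B * sum τ                              ≡⟨ *-distribˡ-sum B τ ⟩
  ∑[ j < n ] (B * τ j)                   ≡⟨ sum-cong-≋ cols ⟨
  ∑[ j < n ] ((∑[ x < m ] c x j) * v j)  ≡⟨ sum-cong-≋ (λ j → *-distribʳ-sum (v j) (λ x → c x j)) ⟩
  ∑[ j < n ] ∑[ x < m ] (c x j * v j)    ≡⟨ ∑-comm (λ x j → c x j * v j) ⟨
  ∑[ x < m ] ∑[ j < n ] (c x j * v j)    <⟨ ∑-mono-< (∑-mono-≤ ∘ c*v≤c*w) x₀ (∑-mono-< (c*v≤c*w x₀) j₀ c*v<c*w) ⟩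
  ∑[ x < m ] ∑[ j < n ] (c x j * w x)    ≡⟨ sum-cong-≋ (λ x → *-distribʳ-sum (w x) (c x)) ⟨
  ∑[ x < m ] ((∑[ j < n ] c x j) * w x)  ≡⟨ sum-cong-≋ rows ⟩
  ∑[ x < m ] (A * σ x)                   ≡⟨ *-distribˡ-sum A σ ⟨
  A * sum σ                              ∎
  where open ≤-Reasoning

module TwoFold {m n : ℕ} (S : Fin m → Bool) (T : Fin n → Bool) (I : Fin m → Fin n → Bool) where

  s : ℕ
  s = ∑[ x < m ] ⟦ S x ⟧

  t : ℕ
  t = ∑[ j < n ] ⟦ T j ⟧

  pointsOn : Fin n → ℕ
  pointsOn j = ∑[ x < m ] (⟦ S x ⟧ * ⟦ I x j ⟧)

  pointsOff : Fin n → ℕ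
  pointsOff j = ∑[ x < m ] (⟦ S x ⟧ * ⟦ not (I x j) ⟧)

  linesThrough : Fin m → ℕ
  linesThrough x = ∑[ j < n ] (⟦ T j ⟧ * ⟦ I x j ⟧)

  linesAvoiding : Fin m → ℕ
  linesAvoiding x = ∑[ j < n ] (⟦ T j ⟧ * ⟦ not (I x j) ⟧)

  commonLines : Fin m → Fin m → ℕ
  commonLines x y = ∑[ j < n ] (⟦ T j ⟧ * ⟦ I x j ⟧ * ⟦ I y j ⟧)

  commonPoints : Fin n → Fin n → ℕ
  commonPoints j j′ = ∑[ x < m ] (⟦ S x ⟧ * ⟦ I x j ⟧ * ⟦ I x j′ ⟧)

  pointsOnLinesThrough : Fin m → ℕ
  pointsOnLinesThrough x = ∑[ j < n ] (⟦ T j ⟧ * ⟦ I x j ⟧ * pointsOn j)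

  pointsOff+pointsOn≡s : ∀ j → pointsOff j + pointsOn j ≡ s
  pointsOff+pointsOn≡s j = ∑-split S (λ x → I x j)

  linesAvoiding+linesThrough≡t : ∀ x → linesAvoiding x + linesThrough x ≡ t
  linesAvoiding+linesThrough≡t x = ∑-split T (I x)

  pointsOn≤s : ∀ j → pointsOn j ≤ s
  pointsOn≤s j = subst (pointsOn j ≤_) (pointsOff+pointsOn≡s j) (m≤n+m _ _)

  linesThrough≤t : ∀ x → linesThrough x ≤ t
  linesThrough≤t x = subst (linesThrough x ≤_) (linesAvoiding+linesThrough≡t x) (m≤n+m _ _)

  commonLines-diag : ∀ x → commonLines x x ≡ linesThrough x
  commonLines-diag x = sum-cong-≋ λ j → trans (*-assoc ⟦ T j ⟧ _ _) (cong (⟦ T j ⟧ *_) (⟦⟧-idem (I x j)))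

  pointsOn≤commonPoints : ∀ {j j′} → (∀ x → S x ≡ true → I x j′ ≡ true) → pointsOn j ≤ commonPoints j j′
  pointsOn≤commonPoints S⊆j′ = ∑-mono-≤ λ x →
    ≤-trans (≤-reflexive (sym (*-identityʳ _))) (⟦⟧*⟦⟧*-mono λ Sx _ → ≤-reflexive (cong ⟦_⟧ (sym (S⊆j′ x Sx))))

  linesThrough≤commonLines : ∀ {x y} → (∀ j → T j ≡ true → I y j ≡ true) → linesThrough x ≤ commonLines x y
  linesThrough≤commonLines T∋y = ∑-mono-≤ λ j →
    ≤-trans (≤-reflexive (sym (*-identityʳ _))) (⟦⟧*⟦⟧*-mono λ Tj _ → ≤-reflexive (cong ⟦_⟧ (sym (T∋y j Tj))))

  missed-point : ¬ (∃[ j ] T j ≡ true × (∀ x → S x ≡ true → I x j ≡ true)) →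
                 ∀ {j} → T j ≡ true → ∃[ x ] S x ≡ true × I x j ≡ false
  missed-point ¬S⊆line {j} Tj = ∃-counterexample S (λ x → I x j) λ S⊆j → ¬S⊆line (j , Tj , S⊆j)

  avoided-line : ¬ (∃[ x ] S x ≡ true × (∀ j → T j ≡ true → I x j ≡ true)) →
                 ∀ {x} → S x ≡ true → ∃[ j ] T j ≡ true × I x j ≡ false
  avoided-line ¬T∋point {x} Sx = ∃-counterexample T (I x) λ T∋x → ¬T∋point (x , Sx , T∋x)

  record IsTwoFold : Set where
    field
      0<pointsOn : ∀ {j} → T j ≡ true → 0 < pointsOn j
      commonLines≡2 : ∀ {x y} → S x ≡ true → S y ≡ true → x ≢ y → commonLines x y ≡ 2
      commonPoints≤2 : ∀ {j j′} → T j ≡ true → T j′ ≡ true → j ≢ j′ → commonPoints j j′ ≤ 2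

  module _ (isTwoFold : IsTwoFold) where
    open IsTwoFold isTwoFold

    pointsOn≤linesThrough : ∀ {x j} → S x ≡ true → T j ≡ true → I x j ≡ false → pointsOn j ≤ linesThrough x
    pointsOn≤linesThrough {x} {j} Sx Tj x∉j = *-cancelʳ-≤ _ _ 2 (begin
      pointsOn j * 2
        ≡⟨ *-distribʳ-sum 2 (λ y → ⟦ S y ⟧ * ⟦ I y j ⟧) ⟩
      ∑[ y < m ] (⟦ S y ⟧ * ⟦ I y j ⟧ * 2)
        ≤⟨ ∑-mono-≤ (λ y → ⟦⟧*⟦⟧*-mono (two-lines y)) ⟩
      ∑[ y < m ] (⟦ S y ⟧ * ⟦ I y j ⟧ * commonLines x y)
        ≡⟨ ∑-swap (λ y → ⟦ S y ⟧ * ⟦ I y j ⟧) (λ j′ → ⟦ T j′ ⟧ * ⟦ I x j′ ⟧) (λ y j′ → ⟦ I y j′ ⟧) ⟩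
      ∑[ j′ < n ] (⟦ T j′ ⟧ * ⟦ I x j′ ⟧ * commonPoints j j′)
        ≤⟨ ∑-mono-≤ (λ j′ → ⟦⟧*⟦⟧*-mono (two-points j′)) ⟩
      ∑[ j′ < n ] (⟦ T j′ ⟧ * ⟦ I x j′ ⟧ * 2)
        ≡⟨ *-distribʳ-sum 2 (λ j′ → ⟦ T j′ ⟧ * ⟦ I x j′ ⟧) ⟨
      linesThrough x * 2
        ∎)
      where
      open ≤-Reasoning
      two-lines : ∀ y → S y ≡ true → I y j ≡ true → 2 ≤ commonLines x y
      two-lines y Sy y∈j = ≤-reflexive (sym (commonLines≡2 Sx Sy (≢-separated (λ z → I z j) x∉j y∈j)))
      two-points : ∀ j′ → T j′ ≡ true → I x j′ ≡ true → commonPoints j j′ ≤ 2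
      two-points j′ Tj′ x∈j′ = commonPoints≤2 Tj Tj′ (≢-separated (I x) x∉j x∈j′)

    linesThrough+s*2≤pointsOnLinesThrough+2 : ∀ {x₀} → S x₀ ≡ true →
                                              linesThrough x₀ + s * 2 ≤ pointsOnLinesThrough x₀ + 2
    linesThrough+s*2≤pointsOnLinesThrough+2 {x₀} Sx₀ = begin
      linesThrough x₀ + s * 2
        ≡⟨ cong (linesThrough x₀ +_) (*-distribʳ-sum 2 (λ y → ⟦ S y ⟧)) ⟩
      linesThrough x₀ + ∑[ y < m ] (⟦ S y ⟧ * 2)
        ≡⟨ +-comm (linesThrough x₀) _ ⟩
      ∑[ y < m ] (⟦ S y ⟧ * 2) + linesThrough x₀
        ≤⟨ ∑-mono-≤-except x₀ two-lines at-x₀ ⟩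
      ∑[ y < m ] (⟦ S y ⟧ * commonLines x₀ y) + 2
        ≡⟨ cong (_+ 2) (∑-swap (λ y → ⟦ S y ⟧) (λ j → ⟦ T j ⟧ * ⟦ I x₀ j ⟧) (λ y j → ⟦ I y j ⟧)) ⟩
      pointsOnLinesThrough x₀ + 2
        ∎
      where
      open ≤-Reasoning
      two-lines : ∀ y → y ≢ x₀ → ⟦ S y ⟧ * 2 ≤ ⟦ S y ⟧ * commonLines x₀ y
      two-lines y y≢x₀ = ⟦⟧*-mono λ Sy → ≤-reflexive (sym (commonLines≡2 Sx₀ Sy (y≢x₀ ∘ sym)))
      at-x₀ : ⟦ S x₀ ⟧ * 2 + linesThrough x₀ ≤ ⟦ S x₀ ⟧ * commonLines x₀ x₀ + 2
      at-x₀ rewrite Sx₀ | commonLines-diag x₀ =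
        ≤-reflexive (trans (+-comm 2 _) (cong (_+ 2) (sym (*-identityˡ _))))

    s≤linesThrough : ∀ {x₀ j₀} → S x₀ ≡ true → T j₀ ≡ true → (∀ x → S x ≡ true → I x j₀ ≡ true) →
                     s ≤ linesThrough x₀
    s≤linesThrough {x₀} {j₀} Sx₀ Tj₀ S⊆j₀ = +-cancelˡ-≤ (r + s) s r (begin
      r + s + s                                  ≡⟨ regroupˡ r s ⟩
      r + s * 2                                  ≤⟨ linesThrough+s*2≤pointsOnLinesThrough+2 Sx₀ ⟩
      pointsOnLinesThrough x₀ + 2                ≤⟨ ∑-mono-≤-except j₀ off-j₀ at-j₀ ⟩
      ∑[ j < n ] (⟦ T j ⟧ * ⟦ I x₀ j ⟧ * 2) + s  ≡⟨ cong (_+ s) (*-distribʳ-sum 2 (λ j → ⟦ T j ⟧ * ⟦ I x₀ j ⟧)) ⟨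
      r * 2 + s                                  ≡⟨ regroupʳ r s ⟩
      r + s + r                                  ∎)
      where
      open ≤-Reasoning
      r : ℕ
      r = linesThrough x₀
      regroupˡ : ∀ p q → p + q + q ≡ p + q * 2
      regroupˡ = solve-∀
      regroupʳ : ∀ p q → p * 2 + q ≡ p + q + p
      regroupʳ = solve-∀
      off-j₀ : ∀ j → j ≢ j₀ → ⟦ T j ⟧ * ⟦ I x₀ j ⟧ * pointsOn j ≤ ⟦ T j ⟧ * ⟦ I x₀ j ⟧ * 2
      off-j₀ j j≢j₀ = ⟦⟧*⟦⟧*-mono λ Tj _ → ≤-trans (pointsOn≤commonPoints S⊆j₀) (commonPoints≤2 Tj Tj₀ j≢j₀)
      at-j₀ : ⟦ T j₀ ⟧ * ⟦ I x₀ j₀ ⟧ * pointsOn j₀ + 2 ≤ ⟦ T j₀ ⟧ * ⟦ I x₀ j₀ ⟧ * 2 + s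
      at-j₀ rewrite Tj₀ | S⊆j₀ x₀ Sx₀ =
        ≤-trans (≤-reflexive (trans (cong (_+ 2) (*-identityˡ _)) (+-comm _ 2))) (+-monoʳ-≤ 2 (pointsOn≤s j₀))

    point-on-all-lines⇒s≤t : ∀ {x₀} → 2 ≤ s → S x₀ ≡ true → (∀ j → T j ≡ true → I x₀ j ≡ true) →
                             (∀ {j} → T j ≡ true → ∃[ y ] S y ≡ true × I y j ≡ false) → s ≤ t
    point-on-all-lines⇒s≤t {x₀} 2≤s Sx₀ T∋x₀ missed = +-cancelʳ-≤ 2 s t (begin
      s + 2  ≤⟨ +-monoʳ-≤ s 2≤s ⟩
      s + s  ≡⟨ regroup s ⟩
      s * 2  ≤⟨ +-cancelˡ-≤ r (s * 2) (r + 2) r+s*2≤r+[r+2] ⟩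
      r + 2  ≤⟨ +-monoˡ-≤ 2 (linesThrough≤t x₀) ⟩
      t + 2  ∎)
      where
      open ≤-Reasoning
      r : ℕ
      r = linesThrough x₀
      regroup : ∀ p → p + p ≡ p * 2
      regroup = solve-∀
      regroup′ : ∀ p → p * 2 + 2 ≡ p + (p + 2)
      regroup′ = solve-∀
      pointsOn≤2 : ∀ {j} → T j ≡ true → pointsOn j ≤ 2
      pointsOn≤2 {j} Tj with missed Tj
      ... | y , Sy , y∉j = begin
        pointsOn j        ≤⟨ pointsOn≤linesThrough Sy Tj y∉j ⟩
        linesThrough y    ≤⟨ linesThrough≤commonLines T∋x₀ ⟩
        commonLines y x₀  ≡⟨ commonLines≡2 Sy Sx₀ (≢-separated (λ z → I z j) y∉j (T∋x₀ j Tj)) ⟩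
        2                 ∎
      r+s*2≤r+[r+2] : r + s * 2 ≤ r + (r + 2)
      r+s*2≤r+[r+2] = begin
        r + s * 2
          ≤⟨ linesThrough+s*2≤pointsOnLinesThrough+2 Sx₀ ⟩
        pointsOnLinesThrough x₀ + 2
          ≤⟨ +-monoˡ-≤ 2 (∑-mono-≤ λ j → ⟦⟧*⟦⟧*-mono {T j} {I x₀ j} λ Tj _ → pointsOn≤2 Tj) ⟩
        ∑[ j < n ] (⟦ T j ⟧ * ⟦ I x₀ j ⟧ * 2) + 2
          ≡⟨ cong (_+ 2) (*-distribʳ-sum 2 (λ j → ⟦ T j ⟧ * ⟦ I x₀ j ⟧)) ⟨
        r * 2 + 2
          ≡⟨ regroup′ r ⟩
        r + (r + 2)
          ∎

    module _ (avoided : ∀ {x} → S x ≡ true → ∃[ j ] T j ≡ true × I x j ≡ false)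
             (missed : ∀ {j} → T j ≡ true → ∃[ x ] S x ≡ true × I x j ≡ false)
             (t<s : t < s) where

      nonincident : Fin m → Fin n → ℕ
      nonincident x j = ⟦ S x ⟧ * ⟦ T j ⟧ * ⟦ not (I x j) ⟧

      ∑nonincident-row : ∀ x → ∑[ j < n ] nonincident x j ≡ ⟦ S x ⟧ * linesAvoiding x
      ∑nonincident-row x = trans (sum-cong-≋ λ j → *-assoc ⟦ S x ⟧ ⟦ T j ⟧ _)
                                 (sym (*-distribˡ-sum ⟦ S x ⟧ (λ j → ⟦ T j ⟧ * ⟦ not (I x j) ⟧)))

      ∑nonincident-col : ∀ j → ∑[ x < m ] nonincident x j ≡ ⟦ T j ⟧ * pointsOff j
      ∑nonincident-col j = trans (sum-cong-≋ λ x → exchange ⟦ S x ⟧ ⟦ T j ⟧ _)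
                                 (sym (*-distribˡ-sum ⟦ T j ⟧ (λ x → ⟦ S x ⟧ * ⟦ not (I x j) ⟧)))
        where
        exchange : ∀ a b c → a * b * c ≡ b * (a * c)
        exchange = solve-∀

      0<nonincident : ∀ {x j} → S x ≡ true → T j ≡ true → I x j ≡ false → 0 < nonincident x j
      0<nonincident Sx Tj x∉j rewrite Sx | Tj | x∉j = z<s

      0<linesAvoiding : ∀ {x} → S x ≡ true → 0 < linesAvoiding x
      0<linesAvoiding Sx with avoided Sx
      ... | j , Tj , x∉j = 0<∑ j (0<⟦⟧*⟦⟧ Tj (cong not x∉j))

      0<pointsOff : ∀ {j} → T j ≡ true → 0 < pointsOff j
      0<pointsOff Tj with missed Tj
      ... | x , Sx , x∉j = 0<∑ x (0<⟦⟧*⟦⟧ Sx (cong not x∉j))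

      linesAvoiding≤s : ∀ x → linesAvoiding x ≤ s
      linesAvoiding≤s x =
        ≤-trans (subst (linesAvoiding x ≤_) (linesAvoiding+linesThrough≡t x) (m≤m+n _ _)) (<⇒≤ t<s)

      pointsOff≤s : ∀ j → pointsOff j ≤ s
      pointsOff≤s j = subst (pointsOff j ≤_) (pointsOff+pointsOn≡s j) (m≤m+n _ _)

      s*linesAvoiding<t*pointsOff : ∀ {x j} → S x ≡ true → T j ≡ true → I x j ≡ false →
                                    s * linesAvoiding x < t * pointsOff j
      s*linesAvoiding<t*pointsOff {x} {j} Sx Tj x∉j = +-cancelʳ-< (s * r) (s * d) (t * e) (begin-strict
        s * d + s * r  ≡⟨ *-distribˡ-+ s d r ⟨
        s * (d + r)    ≡⟨ cong (s *_) (linesAvoiding+linesThrough≡t x) ⟩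
        s * t          ≡⟨ *-comm s t ⟩
        t * s          ≡⟨ cong (t *_) (pointsOff+pointsOn≡s j) ⟨
        t * (e + a)    ≡⟨ *-distribˡ-+ t e a ⟩
        t * e + t * a  <⟨ +-monoʳ-< (t * e) t*a<s*r ⟩
        t * e + s * r  ∎)
        where
        open ≤-Reasoning
        a d e r : ℕ
        a = pointsOn j
        d = linesAvoiding x
        e = pointsOff j
        r = linesThrough x
        t*a<s*r : t * a < s * r
        t*a<s*r = <-≤-trans (*-monoˡ-< a {{>-nonZero (0<pointsOn Tj)}} t<s)
                            (*-monoʳ-≤ s (pointsOn≤linesThrough Sx Tj x∉j))

      rowSum∣ : ∀ x → ⟦ S x ⟧ * linesAvoiding x ∣ s ! * ⟦ S x ⟧
      rowSum∣ x = ⟦⟧*-∣ λ Sx → 0<m≤n⇒m∣n! (0<linesAvoiding Sx) (linesAvoiding≤s x)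

      colSum∣ : ∀ j → ⟦ T j ⟧ * pointsOff j ∣ s ! * ⟦ T j ⟧
      colSum∣ j = ⟦⟧*-∣ λ Tj → 0<m≤n⇒m∣n! (0<pointsOff Tj) (pointsOff≤s j)

      -- On S and T these are s! / linesAvoiding x and s! / pointsOff j, the weights of the
      -- fractional double count scaled by s!.
      rowWeight : Fin m → ℕ
      rowWeight x = quotient (rowSum∣ x)

      colWeight : Fin n → ℕ
      colWeight j = quotient (colSum∣ j)

      s*colWeight<t*rowWeight : ∀ {x j} → S x ≡ true → T j ≡ true → I x j ≡ false →
                                s * colWeight j < t * rowWeight x
      s*colWeight<t*rowWeight {x} {j} Sx Tj x∉j =
        reciprocal-< {W = rowWeight x} {colWeight j} {a = s} {t} {{s !≢0}}
          (quotient-⟦⟧ (rowSum∣ x) Sx) (quotient-⟦⟧ (colSum∣ j) Tj) (s*linesAvoiding<t*pointsOff Sx Tj x∉j)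

      weighted : ∀ {R σ K W} a → K * σ ≡ W * R → R * (a * W) ≡ a * K * σ
      weighted {R} {σ} {K} {W} a K*σ≡W*R = begin
        R * (a * W)  ≡⟨ exchange R a W ⟩
        a * (W * R)  ≡⟨ cong (a *_) K*σ≡W*R ⟨
        a * (K * σ)  ≡⟨ *-assoc a K σ ⟨
        a * K * σ    ∎
        where
        open ≡-Reasoning
        exchange : ∀ p q r → p * (q * r) ≡ q * (r * p)
        exchange = solve-∀

      rows : ∀ x → (∑[ j < n ] nonincident x j) * (t * rowWeight x) ≡ t * s ! * ⟦ S x ⟧
      rows x = trans (cong (_* (t * rowWeight x)) (∑nonincident-row x))
                     (weighted {R = ⟦ S x ⟧ * linesAvoiding x} {W = rowWeight x} t (_∣_.equality (rowSum∣ x)))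

      cols : ∀ j → (∑[ x < m ] nonincident x j) * (s * colWeight j) ≡ s * s ! * ⟦ T j ⟧
      cols j = trans (cong (_* (s * colWeight j)) (∑nonincident-col j))
                     (weighted {R = ⟦ T j ⟧ * pointsOff j} {W = colWeight j} s (_∣_.equality (colSum∣ j)))

      nonincident-≤ : ∀ x j → nonincident x j * (s * colWeight j) ≤ nonincident x j * (t * rowWeight x)
      nonincident-≤ x j = ⟦⟧*⟦⟧*⟦not⟧*-mono λ Sx Tj x∉j → <⇒≤ (s*colWeight<t*rowWeight Sx Tj x∉j)

      t<s-absurd : ∀ {x₀} → S x₀ ≡ true → ⊥
      t<s-absurd {x₀} Sx₀ with avoided Sx₀
      ... | j₀ , Tj₀ , x₀∉j₀ = <-irrefl (commute s (s !) t)
        (double-count-< nonincident {λ x → t * rowWeight x} {λ j → s * colWeight j} {A = t * s !} {s * s !}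
          rows cols nonincident-≤ x₀ j₀
          (*-monoʳ-< _ {{>-nonZero (0<nonincident Sx₀ Tj₀ x₀∉j₀)}} (s*colWeight<t*rowWeight Sx₀ Tj₀ x₀∉j₀)))
        where
        commute : ∀ p K q → p * K * q ≡ q * K * p
        commute = solve-∀

    s≤t : 2 ≤ s → s ≤ t
    s≤t 2≤s with ∃-true S (≤-trans (s≤s z≤n) 2≤s)
    ... | x₀ , Sx₀ with any? (λ j → T j ≟ true ×-dec all? λ x → S x ≟ true →-dec I x j ≟ true)
    ...   | yes (j₀ , Tj₀ , S⊆j₀) = ≤-trans (s≤linesThrough Sx₀ Tj₀ S⊆j₀) (linesThrough≤t x₀)
    ...   | no ¬S⊆line with any? (λ x → S x ≟ true ×-dec all? λ j → T j ≟ true →-dec I x j ≟ true)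
    ...     | yes (x₁ , Sx₁ , T∋x₁) = point-on-all-lines⇒s≤t 2≤s Sx₁ T∋x₁ (missed-point ¬S⊆line)
    ...     | no ¬T∋point = ≮⇒≥ λ t<s → t<s-absurd (avoided-line ¬T∋point) (missed-point ¬S⊆line) t<s Sx₀

∣p∣≡∑⟦p⟧ : ∀ {n} (p : Subset n) → ∣ p ∣ ≡ ∑[ i < n ] ⟦ lookup p i ⟧
∣p∣≡∑⟦p⟧ [] = refl
∣p∣≡∑⟦p⟧ (true ∷ p) = cong suc (∣p∣≡∑⟦p⟧ p)
∣p∣≡∑⟦p⟧ (false ∷ p) = ∣p∣≡∑⟦p⟧ p

∣p∩q∣≡∑⟦p⟧*⟦q⟧ : ∀ {n} (p q : Subset n) → ∣ p ∩ q ∣ ≡ ∑[ i < n ] (⟦ lookup p i ⟧ * ⟦ lookup q i ⟧)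
∣p∩q∣≡∑⟦p⟧*⟦q⟧ [] [] = refl
∣p∩q∣≡∑⟦p⟧*⟦q⟧ (true ∷ p) (true ∷ q) = cong suc (∣p∩q∣≡∑⟦p⟧*⟦q⟧ p q)
∣p∩q∣≡∑⟦p⟧*⟦q⟧ (true ∷ p) (false ∷ q) = ∣p∩q∣≡∑⟦p⟧*⟦q⟧ p q
∣p∩q∣≡∑⟦p⟧*⟦q⟧ (false ∷ p) (_ ∷ q) = ∣p∩q∣≡∑⟦p⟧*⟦q⟧ p q

does-∈? : ∀ {n} (x : Fin n) (p : Subset n) → does (x ∈? p) ≡ lookup p x
does-∈? zero (true ∷ p) = refl
does-∈? zero (false ∷ p) = refl
does-∈? (suc x) (_ ∷ p) = does-∈? x p

x∈p∧y∈p∧x≢y⇒2≤∣p∣ : ∀ {n} {p : Subset n} {x y} → x ∈ p → y ∈ p → x ≢ y → 2 ≤ ∣ p ∣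
x∈p∧y∈p∧x≢y⇒2≤∣p∣ {p = p} {x} {y} x∈p y∈p x≢y =
  ≤-trans (s≤s (≤-trans (s≤s z≤n) (x∈p⇒∣p-x∣<∣p∣ y∈p-x))) (x∈p⇒∣p-x∣<∣p∣ x∈p)
  where
  y∈p-x : y ∈ p - x
  y∈p-x = x∈p∧x∉q⇒x∈p─q y∈p (x≢y⇒x∉⁅y⁆ (x≢y ∘ sym))

module _ {v} {blk : Fin v → Subset v} (biplane : IsBiplane v blk) (S : Subset v) where
  open IsBiplane biplane
  open TwoFold (lookup S) (lookup (Λ² blk S)) (λ x j → lookup (blk j) x)

  lookup-Λ² : ∀ j → lookup (Λ² blk S) j ≡ does (2 ≤? ∣ S ∩ blk j ∣)
  lookup-Λ² j = lookup∘tabulate (λ j → does (2 ≤? ∣ S ∩ blk j ∣)) j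

  Λ²⁺ : ∀ {j} → 2 ≤ ∣ S ∩ blk j ∣ → lookup (Λ² blk S) j ≡ true
  Λ²⁺ {j} 2≤∣S∩j∣ = trans (lookup-Λ² j) (dec-true (2 ≤? ∣ S ∩ blk j ∣) 2≤∣S∩j∣)

  Λ²⁻ : ∀ {j} → lookup (Λ² blk S) j ≡ true → 2 ≤ ∣ S ∩ blk j ∣
  Λ²⁻ {j} j∈Λ² = ≤ᵇ⇒≤ 2 ∣ S ∩ blk j ∣ (Equivalence.from T-≡ (trans (sym (lookup-Λ² j)) j∈Λ²))

  0<pointsOn-Λ² : ∀ {j} → lookup (Λ² blk S) j ≡ true → 0 < pointsOn j
  0<pointsOn-Λ² {j} j∈Λ² = subst (0 <_) (∣p∩q∣≡∑⟦p⟧*⟦q⟧ S (blk j)) (≤-trans (s≤s z≤n) (Λ²⁻ j∈Λ²))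

  commonLines≡∣blocksThrough∣ : ∀ {x y} → lookup S x ≡ true → lookup S y ≡ true → x ≢ y →
                                commonLines x y ≡ ∣ blocksThrough blk x y ∣
  commonLines≡∣blocksThrough∣ {x} {y} Sx Sy x≢y = begin
    commonLines x y
      ≡⟨ sum-cong-≋ (λ j → ⟦⟧*⟦⟧*⟦⟧≡⟦∧⟧ (through-x-y⇒Λ² j)) ⟩
    ∑[ j < v ] ⟦ lookup (blk j) x ∧ lookup (blk j) y ⟧
      ≡⟨ sum-cong-≋ (λ j → cong ⟦_⟧ (lookup-blocksThrough j)) ⟨
    ∑[ j < v ] ⟦ lookup (blocksThrough blk x y) j ⟧
      ≡⟨ ∣p∣≡∑⟦p⟧ (blocksThrough blk x y) ⟨
    ∣ blocksThrough blk x y ∣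
      ∎
    where
    open ≡-Reasoning
    lookup-blocksThrough : ∀ j → lookup (blocksThrough blk x y) j ≡ lookup (blk j) x ∧ lookup (blk j) y
    lookup-blocksThrough j =
      trans (lookup∘tabulate _ j) (cong₂ _∧_ (does-∈? x (blk j)) (does-∈? y (blk j)))
    through-x-y⇒Λ² : ∀ j → lookup (blk j) x ≡ true → lookup (blk j) y ≡ true → lookup (Λ² blk S) j ≡ true
    through-x-y⇒Λ² j x∈j y∈j = Λ²⁺ (x∈p∧y∈p∧x≢y⇒2≤∣p∣ (∈S∩blk Sx x∈j) (∈S∩blk Sy y∈j) x≢y)
      where
      ∈S∩blk : ∀ {z} → lookup S z ≡ true → lookup (blk j) z ≡ true → z ∈ S ∩ blk j
      ∈S∩blk {z} Sz z∈j = x∈p∩q⁺ (lookup⇒[]= z S Sz , lookup⇒[]= z (blk j) z∈j)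

  commonPoints≤∣blk∩blk∣ : ∀ j j′ → commonPoints j j′ ≤ ∣ blk j ∩ blk j′ ∣
  commonPoints≤∣blk∩blk∣ j j′ = begin
    commonPoints j j′
      ≤⟨ ∑-mono-≤ (λ x → ⟦⟧*⟦⟧*⟦⟧≤⟦⟧*⟦⟧ (lookup S x) (lookup (blk j) x) (lookup (blk j′) x)) ⟩
    ∑[ x < v ] (⟦ lookup (blk j) x ⟧ * ⟦ lookup (blk j′) x ⟧)
      ≡⟨ ∣p∩q∣≡∑⟦p⟧*⟦q⟧ (blk j) (blk j′) ⟨
    ∣ blk j ∩ blk j′ ∣
      ∎
    where open ≤-Reasoning

  incidence-isTwoFold : IsTwoFold
  incidence-isTwoFold = record
    { 0<pointsOn = 0<pointsOn-Λ²
    ; commonLines≡2 = λ Sx Sy x≢y → trans (commonLines≡∣blocksThrough∣ Sx Sy x≢y) (pointPairs _ _ x≢y)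
    ; commonPoints≤2 = λ {j} {j′} _ _ j≢j′ →
        ≤-trans (commonPoints≤∣blk∩blk∣ j j′) (≤-reflexive (blockPairs j j′ j≢j′))
    }

  2≤∣S∣⇒∣S∣≤∣Λ²S∣ : 2 ≤ ∣ S ∣ → ∣ S ∣ ≤ ∣ Λ² blk S ∣
  2≤∣S∣⇒∣S∣≤∣Λ²S∣ 2≤∣S∣ = subst₂ _≤_ (sym (∣p∣≡∑⟦p⟧ S)) (sym (∣p∣≡∑⟦p⟧ (Λ² blk S)))
    (s≤t incidence-isTwoFold (subst (2 ≤_) (∣p∣≡∑⟦p⟧ S) 2≤∣S∣))

lemma5p1 : (v : ℕ) (blk : Fin v → Subset v) → 2 ≤ v → IsBiplane v blk → DoubleHall v blk
lemma5p1 v blk 2≤v biplane = 2≤v , 2≤∣S∣⇒∣S∣≤∣Λ²S∣ biplane
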